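{- Let $D$ be a positive integer that is not a perfect square. Suppose that $T_D=2L$ for some positive integer $L$, that $Q_L$ is even and that $Q_L$ is not divisible by $4$. Then $a_L\equiv D\pmod 2$.
   Context: For a positive non-square integer $D$, define $\omega_0=\sqrt D$ and recursively $a_k=\lfloor\omega_k\rfloor$, $\omega_{k+1}=1/(\omega_k-a_k)$, so that $\sqrt D=[a_0;a_1,a_2,\ldots]=[a_0;\overline{a_1,\ldots,a_l}]$ with minimal period length $l=T_D$. For each $k\ge0$ one has $\omega_k=\frac{\sqrt D+P_k}{Q_k}$ for uniquely determined integers $P_k,Q_k$ (with $P_0=0$, $Q_0=1$, $P_{k+1}=a_kQ_k-P_k$, $Q_{k+1}=(D-P_{k+1}^2)/Q_k$). -}

module Defs where

open import Data.Nat using (ℕ; suc)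
open import Data.Integer using (ℤ; +_; _+_; _-_; _*_; _≤_; _<_; 0ℤ; 1ℤ)
open import Data.Product using (_×_)
open import Data.Sum using (_⊎_)
open import Relation.Binary.PropositionalEquality using (_≡_)

-- Comparisons of an integer x with √D (D ≥ 0), expressed without reals.
-- x ≤ √D
LeSqrt : ℕ → ℤ → Set
LeSqrt D x = x ≤ 0ℤ ⊎ x * x ≤ + D

LtSqrt : ℕ → ℤ → Set
LtSqrt D x = x < 0ℤ ⊎ x * x < + D

SqrtLe : ℕ → ℤ → Set
SqrtLe D y = 0ℤ ≤ y × + D ≤ y * y

SqrtLt : ℕ → ℤ → Set
SqrtLt D y = 0ℤ < y × + D < y * y

-- a = ⌊ (√D + P) / Q ⌋, i.e. a ≤ (√D + P)/Q < a + 1 (Q ≠ 0, either sign).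
IsFloor : ℕ → ℤ → ℤ → ℤ → Set
IsFloor D P Q a =
    (0ℤ < Q × LeSqrt D (a * Q - P) × SqrtLt D ((a + 1ℤ) * Q - P))
  ⊎ (Q < 0ℤ × SqrtLe D (a * Q - P) × LtSqrt D ((a + 1ℤ) * Q - P))

-- The sequences a, P, Q of the continued fraction expansion of √D:
-- ω_k = (√D + P_k)/Q_k, a_k = ⌊ω_k⌋, P_0 = 0, Q_0 = 1,
-- P_{k+1} = a_k Q_k - P_k, Q_{k+1} Q_k = D - P_{k+1}^2.
-- (These conditions determine a, P, Q uniquely.)
record IsSqrtCF (D : ℕ) (a P Q : ℕ → ℤ) : Set where
  field
    P-zero  : P 0 ≡ 0ℤ
    Q-zero  : Q 0 ≡ 1ℤ
    a-floor : ∀ k → IsFloor D (P k) (Q k) (a k)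
    P-suc   : ∀ k → P (suc k) ≡ a k * Q k - P k
    Q-suc   : ∀ k → Q (suc k) * Q k ≡ + D - P (suc k) * P (suc k)

-- l is a period of the purely periodic tail a_1, a_2, ...
IsPeriod : (ℕ → ℤ) → ℕ → Set
IsPeriod a l = ∀ k → 1 Data.Nat.≤ k → a (k Data.Nat.+ l) ≡ a k

IsMinPeriod : (ℕ → ℤ) → ℕ → Set
IsMinPeriod a l =
  0 Data.Nat.< l × IsPeriod a l × (∀ m → 0 Data.Nat.< m → IsPeriod a m → l Data.Nat.≤ m)

-- With r = ⌊√D⌋, every ω_k = (√D + P_k)/Q_k with k ≥ 1 is reduced, which for the integers
-- P_k, Q_k reads 0 < P_k ≤ r < P_k + Q_k ≤ 2P_k + r; in particular the pairs (P_k, Q_k) take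
-- finitely many values and each step of the expansion can be run backwards.  A period l of a
-- is also a period of (P, Q): along the expansion, Q_k Q_{k+l}(ω_k − ω_{k+l}) ∈ ℤ[√D] is
-- multiplied by elements with positive coordinates, and after a period of (P, Q) it returns
-- to an integer multiple of itself; as ℤ[√D] is a domain, it vanishes.  Running the
-- recurrences backwards from the end of the period gives P_{k+1} = P_{l−k}, so for l = 2L the
-- middle yields P_{L+1} = P_L, i.e. a_L Q_L = 2P_L.  Writing Q_L = 2t with t odd, P_L = a_L t
-- and D = P_L² + Q_L Q_{L−1} ≡ a_L² t² ≡ a_L (mod 2).

module Submission where

open import Defs
import Data.Nat as ℕ
import Data.Nat.Properties as ℕₚ
open import Data.Integer using (ℤ)
open import Data.Product using (_,_; proj₁)
open import Relation.Binary.PropositionalEquality using (_≡_; _≢_; cong; sym)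

module Irrationality where
  open import Data.Nat
  open import Data.Nat.Properties
  open import Data.Nat.Divisibility
  open import Data.Nat.GCD
  open import Data.Nat.Coprimality as Coprimality using (Coprime; GCD≡1⇒coprime; coprime-divisor)
  open import Data.Nat.Tactic.RingSolver using (solve-∀)
  open import Data.Product using (∃-syntax; _,_)
  open import Data.Sum using (inj₂)
  open import Relation.Binary.PropositionalEquality

  rational-root⇒square : ∀ d e f → f ≢ 0 → d * (f * f) ≡ e * e → ∃[ n ] n * n ≡ d
  rational-root⇒square d e f f≢0 d[ff]≡ee = split (gcd[m,n]∣m e f) (gcd[m,n]∣n e f)
    where
    g = gcd e f
    instance
      g≢0 : NonZero g
      g≢0 = ≢-nonZero (gcd[m,n]≢0 e f (inj₂ f≢0))
      gg≢0 : NonZero (g * g)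
      gg≢0 = m*n≢0 g g

    split : g ∣ e → g ∣ f → ∃[ n ] n * n ≡ d
    split (divides e′ e≡e′g) (divides f′ f≡f′g) = e′ , sym d≡e′e′
      where
      coprime : Coprime e′ f′
      coprime = GCD≡1⇒coprime (GCD-* (subst₂ (λ x y → GCD x y (1 * g)) e≡e′g f≡f′g
                  (subst (GCD e f) (sym (*-identityˡ g)) (gcd-GCD e f))))

      scale : ∀ x g → (x * g) * (x * g) ≡ (x * x) * (g * g)
      scale = solve-∀

      reduced : d * (f′ * f′) ≡ e′ * e′
      reduced = *-cancelʳ-≡ _ _ (g * g) (begin
        d * (f′ * f′) * (g * g)   ≡⟨ *-assoc d (f′ * f′) (g * g) ⟩
        d * ((f′ * f′) * (g * g)) ≡⟨ cong (d *_) (sym (scale f′ g)) ⟩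
        d * ((f′ * g) * (f′ * g)) ≡⟨ cong (λ x → d * (x * x)) (sym f≡f′g) ⟩
        d * (f * f)               ≡⟨ d[ff]≡ee ⟩
        e * e                     ≡⟨ cong (λ x → x * x) e≡e′g ⟩
        (e′ * g) * (e′ * g)       ≡⟨ scale e′ g ⟩
        (e′ * e′) * (g * g)       ∎)
        where open ≡-Reasoning

      f′≡1 : f′ ≡ 1
      f′≡1 = coprime (coprime-divisor (Coprimality.sym coprime)
                       (divides (d * f′) (trans (sym reduced) (sym (*-assoc d f′ f′)))) , ∣-refl)

      d≡e′e′ : d ≡ e′ * e′
      d≡e′e′ = trans (sym (*-identityʳ d)) (subst (λ x → d * (x * x) ≡ e′ * e′) f′≡1 reduced)

module IntegerOrder where
  open ℕ using (suc)
  open import Data.Integer hiding (suc)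
  open import Data.Integer.Properties
  open import Data.Empty using (⊥)
  open import Relation.Nullary.Decidable using (decidable-stable)
  open import Relation.Binary.PropositionalEquality

  0≤i+j : ∀ {i j} → 0ℤ ≤ i → 0ℤ ≤ j → 0ℤ ≤ i + j
  0≤i+j = +-mono-≤

  0≤i*j : ∀ {i j} → 0ℤ ≤ i → 0ℤ ≤ j → 0ℤ ≤ i * j
  0≤i*j {i} {j} 0≤i 0≤j = subst (_≤ i * j) (*-zeroˡ j) (*-monoʳ-≤-nonNeg j {{nonNegative 0≤j}} 0≤i)

  0<i*j : ∀ {i j} → 0ℤ < i → 0ℤ < j → 0ℤ < i * j
  0<i*j {i} {j} 0<i 0<j = subst (_< i * j) (*-zeroˡ j) (*-monoʳ-<-pos j {{positive 0<j}} 0<i)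

  <⇒0≤ : ∀ {i j} → i < j → 0ℤ ≤ j - (1ℤ + i)
  <⇒0≤ i<j = i≤j⇒0≤j-i (i<j⇒suc[i]≤j i<j)

  -- Inequalities are refuted by a certificate: a sum of products of terms known to be
  -- nonnegative which a ring identity shows to be −1.
  0≤⇒≢-1 : ∀ {i} → 0ℤ ≤ i → i ≢ -1ℤ
  0≤⇒≢-1 (+≤+ _) ()

  <-byContradiction : ∀ {i j} → (0ℤ ≤ i - j → ⊥) → i < j
  <-byContradiction {i} {j} refute = decidable-stable (i <? j) (λ i≮j → refute (i≤j⇒0≤j-i (≮⇒≥ i≮j)))

  ≤-byContradiction : ∀ {i j} → (0ℤ ≤ i - (1ℤ + j) → ⊥) → i ≤ j
  ≤-byContradiction {i} {j} refute = decidable-stable (i ≤? j) (λ i≰j → refute (<⇒0≤ (≰⇒> i≰j)))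

  ∣i∣<1+n : ∀ {i n} → 0ℤ ≤ i → i ≤ + n → ∣ i ∣ ℕ.< suc n
  ∣i∣<1+n 0≤i i≤n = ℕ.s≤s (drop‿+≤+ (subst (_≤ _) (sym (0≤i⇒+∣i∣≡i 0≤i)) i≤n))

  0≤⇒∣∣-injective : ∀ {i j} → 0ℤ ≤ i → 0ℤ ≤ j → ∣ i ∣ ≡ ∣ j ∣ → i ≡ j
  0≤⇒∣∣-injective {i} {j} 0≤i 0≤j ∣i∣≡∣j∣ = begin
    i       ≡⟨ sym (0≤i⇒+∣i∣≡i 0≤i) ⟩
    + ∣ i ∣ ≡⟨ cong +_ ∣i∣≡∣j∣ ⟩
    + ∣ j ∣ ≡⟨ 0≤i⇒+∣i∣≡i 0≤j ⟩
    j       ∎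
    where open ≡-Reasoning


module ReducedForms where
  open import Data.Integer
  open import Data.Integer.Properties
  open import Data.Integer.Tactic.RingSolver using (solve-∀)
  open import Data.Product using (_×_; _,_)
  open import Relation.Binary.PropositionalEquality
  open IntegerOrder

  -- b = ⌊(r + p)/q⌋ (q > 0); for r = ⌊√D⌋ this is also ⌊(√D + p)/q⌋.
  FloorDiv : ℤ → ℤ → ℤ → ℤ → Set
  FloorDiv r p q b = b * q - p ≤ r × r < (b + 1ℤ) * q - p

  floorDiv-unique : ∀ {r p q b c} → 0ℤ < q → FloorDiv r p q b → FloorDiv r p q c → b ≡ c
  floorDiv-unique 0<q (lb , ub) (lc , uc) = ≤-antisym (below 0<q lb uc) (below 0<q lc ub)
    where
    certificate : ∀ b c q p r → (b - (1ℤ + c)) * q + (r - (b * q - p)) + ((c + 1ℤ) * q - p - (1ℤ + r)) ≡ -1ℤ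
    certificate = solve-∀

    below : ∀ {r p q b c} → 0ℤ < q → b * q - p ≤ r → r < (c + 1ℤ) * q - p → b ≤ c
    below {r} {p} {q} {b} {c} 0<q bq-p≤r r<[c+1]q-p = ≤-byContradiction λ c<b →
      0≤⇒≢-1 (0≤i+j (0≤i+j (0≤i*j c<b (<⇒≤ 0<q)) (i≤j⇒0≤j-i bq-p≤r)) (<⇒0≤ r<[c+1]q-p))
             (certificate b c q p r)

  -- (√D + P)/Q is reduced (> 1, with conjugate in (-1, 0)) iff these hold for r = ⌊√D⌋.
  record Reduced (r P Q : ℤ) : Set where
    field
      P≤r   : P ≤ r
      r<P+Q : r < P + Q
      Q≤r+P : Q ≤ r + P

  module _ {r P Q : ℤ} (red : Reduced r P Q) where
    open Reduced red

    reduced-Q>0 : 0ℤ < Q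
    reduced-Q>0 = <-byContradiction λ Q≤0 →
      0≤⇒≢-1 (0≤i+j (0≤i+j (<⇒0≤ r<P+Q) (i≤j⇒0≤j-i P≤r)) Q≤0) (certificate P Q r)
      where
      certificate : ∀ P Q r → (P + Q - (1ℤ + r)) + (r - P) + (0ℤ - Q) ≡ -1ℤ
      certificate = solve-∀

    reduced-P>0 : 0ℤ < P
    reduced-P>0 = <-byContradiction λ P≤0 →
      0≤⇒≢-1 (0≤i+j (0≤i+j (0≤i+j (<⇒0≤ r<P+Q) (i≤j⇒0≤j-i Q≤r+P)) P≤0) P≤0) (certificate P Q r)
      where
      certificate : ∀ P Q r → (P + Q - (1ℤ + r)) + (r + P - Q) + (0ℤ - P) + (0ℤ - P) ≡ -1ℤ
      certificate = solve-∀

    floorDiv-pos : ∀ {a} → FloorDiv r P Q a → 1ℤ ≤ a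
    floorDiv-pos {a} (_ , r<[a+1]Q-P) = ≤-byContradiction λ a<1 →
      0≤⇒≢-1 (0≤i+j (0≤i+j (<⇒0≤ r<[a+1]Q-P) (i≤j⇒0≤j-i Q≤r+P)) (0≤i*j a<1 (<⇒≤ reduced-Q>0)))
             (certificate a P Q r)
      where
      certificate : ∀ a P Q r → ((a + 1ℤ) * Q - P - (1ℤ + r)) + (r + P - Q) + (1ℤ - (1ℤ + a)) * Q ≡ -1ℤ
      certificate = solve-∀

    floorDiv-reverse : ∀ a → FloorDiv r (a * Q - P) Q a
    floorDiv-reverse a = subst (_≤ r) (sym (lower a Q P)) P≤r , subst (r <_) (sym (upper a Q P)) r<P+Q
      where
      lower : ∀ a Q P → a * Q - (a * Q - P) ≡ P
      lower = solve-∀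
      upper : ∀ a Q P → (a + 1ℤ) * Q - (a * Q - P) ≡ P + Q
      upper = solve-∀

    floorDiv-step : ∀ {a} → FloorDiv r P Q a → Reduced r (a * Q - P) Q
    floorDiv-step {a} fl@(aQ-P≤r , r<[a+1]Q-P) = record
      { P≤r   = aQ-P≤r
      ; r<P+Q = subst (r <_) (shift a Q P) r<[a+1]Q-P
      ; Q≤r+P = 0≤i-j⇒j≤i {r + (a * Q - P)} {Q} (subst (0ℤ ≤_) (slack a Q P r)
                  (0≤i+j (i≤j⇒0≤j-i P≤r)
                         (0≤i*j {a - 1ℤ} (i≤j⇒0≤j-i (floorDiv-pos {a} fl)) (<⇒≤ reduced-Q>0))))
      }
      where
      shift : ∀ a Q P → (a + 1ℤ) * Q - P ≡ (a * Q - P) + Q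
      shift = solve-∀
      slack : ∀ a Q P r → (r - P) + (a - 1ℤ) * Q ≡ r + (a * Q - P) - Q
      slack = solve-∀

  -- (√D + P)/Q′ = −1/ω̄, where ω̄ = (P − √D)/Q is the conjugate of (√D + P)/Q.
  reduced-flip : ∀ {D r P Q Q′} → r * r < D → D < (r + 1ℤ) * (r + 1ℤ) →
                 Reduced r P Q → Q′ * Q ≡ D - P * P → Reduced r P Q′
  reduced-flip {D} {r} {P} {Q} {Q′} r*r<D D<[r+1]² red Q′Q≡D-PP = record
    { P≤r   = P≤r
    ; r<P+Q = <-byContradiction λ P+Q′≤r →
        0≤⇒≢-1 (0≤i+j (0≤i+j (0≤i*j P+Q′≤r (<⇒≤ (reduced-Q>0 red)))
                             (0≤i*j (i≤j⇒0≤j-i P≤r) (i≤j⇒0≤j-i Q≤r+P)))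
                      (<⇒0≤ r*r<D))
               (trans (lower P Q Q′ r D) (cong (λ x → -1ℤ - x) (i≡j⇒i-j≡0 Q′Q≡D-PP)))
    ; Q≤r+P = ≤-byContradiction λ r+P<Q′ →
        0≤⇒≢-1 (0≤i+j (0≤i+j (0≤i*j r+P<Q′ (<⇒≤ (reduced-Q>0 red)))
                             (0≤i*j (0≤i+j (0≤i+j (i≤j⇒0≤j-i Q≤r+P) (<⇒≤ (reduced-Q>0 red))) (+≤+ ℕ.z≤n))
                                    (<⇒0≤ r<P+Q)))
                      (<⇒0≤ D<[r+1]²))
               (trans (upper P Q Q′ r D) (cong (λ x → -1ℤ - x) (i≡j⇒i-j≡0 (sym Q′Q≡D-PP))))
    }
    where
    open Reduced red
    lower : ∀ P Q Q′ r D → (r - (P + Q′)) * Q + (r - P) * (r + P - Q) + (D - (1ℤ + r * r))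
                           ≡ -1ℤ - (Q′ * Q - (D - P * P))
    lower = solve-∀
    upper : ∀ P Q Q′ r D → (Q′ - (1ℤ + (r + P))) * Q + ((r + P - Q) + Q + 1ℤ) * (P + Q - (1ℤ + r))
                             + ((r + 1ℤ) * (r + 1ℤ) - (1ℤ + D))
                           ≡ -1ℤ - ((D - P * P) - Q′ * Q)
    upper = solve-∀

module Parity where
  open import Data.Integer hiding (∣_∣)
  open import Data.Integer.Properties
  open import Data.Integer.Tactic.RingSolver using (solve-∀)
  open import Data.Integer.DivMod using (_%ℕ_; _/ℕ_; n%ℕd<d; a≡a%ℕn+[a/ℕn]*n)
  import Data.Integer.Divisibility as Unsigned
  open import Data.Integer.Divisibility.Signed
  open import Data.Sum using (_⊎_; inj₁; inj₂)
  open import Data.Empty using (⊥-elim)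
  open import Relation.Nullary using (¬_)
  open import Relation.Binary.PropositionalEquality

  2∣∨2∣-1 : ∀ i → + 2 ∣ i ⊎ + 2 ∣ i - 1ℤ
  2∣∨2∣-1 i with i %ℕ 2 | n%ℕd<d i 2 | a≡a%ℕn+[a/ℕn]*n i 2
  ... | 0 | _ | i≡ = inj₁ (divides (i /ℕ 2) (trans i≡ (+-identityˡ _)))
  ... | 1 | _ | i≡ = inj₂ (divides (i /ℕ 2) (trans (cong (_- 1ℤ) i≡) (cancel (i /ℕ 2 * + 2))))
    where
    cancel : ∀ x → 1ℤ + x - 1ℤ ≡ x
    cancel = solve-∀
  ... | ℕ.suc (ℕ.suc _) | ℕ.s≤s (ℕ.s≤s ()) | _

  2∣i*[i-1] : ∀ i → + 2 ∣ i * (i - 1ℤ)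
  2∣i*[i-1] i with 2∣∨2∣-1 i
  ... | inj₁ 2∣i   = ∣m⇒∣m*n (i - 1ℤ) 2∣i
  ... | inj₂ 2∣i-1 = ∣n⇒∣m*n i 2∣i-1

  parity : ∀ {a q p d q′} → a * q ≡ p + p → d ≡ p * p + q * q′ →
           + 2 Unsigned.∣ q → ¬ (+ 4 Unsigned.∣ q) → + 2 Unsigned.∣ a - d
  parity {a} {q} {p} {d} {q′} aq≡p+p d≡pp+qq′ 2∣q 4∤q with ∣ᵤ⇒∣ {+ 2} {q} 2∣q
  ... | divides t refl = ∣⇒∣ᵤ (subst (+ 2 ∣_) (sym a-d≡) even)
    where
    2∣t-1 : + 2 ∣ t - 1ℤ
    2∣t-1 with 2∣∨2∣-1 t
    ... | inj₂ 2∣t-1        = 2∣t-1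
    ... | inj₁ (divides s refl) = ⊥-elim (4∤q (∣⇒∣ᵤ (divides s (*-assoc s (+ 2) (+ 2)))))

    p≡at : p ≡ a * t
    p≡at = sym (*-cancelʳ-≡ (a * t) p (+ 2) (begin
      a * t * + 2   ≡⟨ *-assoc a t (+ 2) ⟩
      a * (t * + 2) ≡⟨ aq≡p+p ⟩
      p + p         ≡⟨ double p ⟩
      p * + 2       ∎))
      where
      open ≡-Reasoning
      double : ∀ p → p + p ≡ p * + 2
      double = solve-∀

    expand : ∀ a t q′ → a - ((a * t) * (a * t) + (t * + 2) * q′)
                        ≡ - (a * (a - 1ℤ)) - a * a * ((t - 1ℤ) * (t + 1ℤ)) - t * q′ * + 2
    expand = solve-∀

    a-d≡ : a - d ≡ - (a * (a - 1ℤ)) - a * a * ((t - 1ℤ) * (t + 1ℤ)) - t * q′ * + 2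
    a-d≡ = begin
      a - d                                         ≡⟨ cong (λ x → a - x) d≡pp+qq′ ⟩
      a - (p * p + (t * + 2) * q′)                   ≡⟨ cong (λ x → a - (x * x + (t * + 2) * q′)) p≡at ⟩
      a - ((a * t) * (a * t) + (t * + 2) * q′)       ≡⟨ expand a t q′ ⟩
      - (a * (a - 1ℤ)) - a * a * ((t - 1ℤ) * (t + 1ℤ)) - t * q′ * + 2 ∎
      where open ≡-Reasoning

    even : + 2 ∣ - (a * (a - 1ℤ)) - a * a * ((t - 1ℤ) * (t + 1ℤ)) - t * q′ * + 2
    even = ∣m∣n⇒∣m-n (∣m∣n⇒∣m-n (∣m⇒∣-m (2∣i*[i-1] a)) (∣n⇒∣m*n (a * a) (∣m⇒∣m*n (t + 1ℤ) 2∣t-1)))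
                     (divides (t * q′) refl)


module Pigeonhole where
  open import Data.Nat using (ℕ; suc; _+_)
  open import Data.Nat.Properties using (n<1+n; m≤n⇒∃[o]m+o≡n)
  open import Data.Fin using (Fin; toℕ)
  open import Data.Fin.Properties using (pigeonhole)
  open import Data.Product using (∃-syntax; _,_)
  open import Function using (_∘_)
  open import Relation.Binary.PropositionalEquality

  -- Kept abstract: normalising the pigeonhole witness is prohibitively expensive.
  abstract
    sequence-repeats : ∀ {M} (f : ℕ → Fin M) → ∃[ i ] ∃[ o ] f i ≡ f (suc i + o)
    sequence-repeats {M} f with pigeonhole (n<1+n M) (f ∘ toℕ)
    ... | i , j , i<j , f≡ with m≤n⇒∃[o]m+o≡n i<j
    ...   | o , i+1+o≡j = toℕ i , o , trans f≡ (cong f (sym i+1+o≡j))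


module QuadraticIntegers (D : ℕ.ℕ) where
  open import Data.Integer
  open import Data.Integer.Properties
  open import Data.Integer.Tactic.RingSolver using (solve-∀)
  open import Data.Product using (_×_; _,_; proj₁; proj₂; ∃-syntax)
  open import Data.Product.Properties using (,-injectiveˡ; ,-injectiveʳ)
  open import Data.Sum using (inj₁; inj₂)
  open import Data.Empty using (⊥-elim)
  open import Relation.Binary.PropositionalEquality
  open Irrationality
  open IntegerOrder using (0≤i*j; 0<i*j)

  -- (x , y) stands for x + y √D.
  ℤ√D : Set
  ℤ√D = ℤ × ℤ

  infixl 7 _·_
  infixr 7 _⊙_

  _·_ : ℤ√D → ℤ√D → ℤ√D
  (x , y) · (x′ , y′) = (x * x′ + + D * (y * y′) , x * y′ + y * x′)

  _⊙_ : ℤ → ℤ√D → ℤ√D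
  k ⊙ (x , y) = (k * x , k * y)

  ·-assoc : ∀ u v w → (u · v) · w ≡ u · (v · w)
  ·-assoc (x , y) (x′ , y′) (x″ , y″) =
    cong₂ _,_ (rational x y x′ y′ x″ y″ (+ D)) (irrational x y x′ y′ x″ y″ (+ D))
    where
    rational : ∀ x y x′ y′ x″ y″ d → (x * x′ + d * (y * y′)) * x″ + d * ((x * y′ + y * x′) * y″)
                                   ≡ x * (x′ * x″ + d * (y′ * y″)) + d * (y * (x′ * y″ + y′ * x″))
    rational = solve-∀
    irrational : ∀ x y x′ y′ x″ y″ d → (x * x′ + d * (y * y′)) * y″ + (x * y′ + y * x′) * x″
                                     ≡ x * (x′ * y″ + y′ * x″) + y * (x′ * x″ + d * (y′ * y″))
    irrational = solve-∀

  ⊙-· : ∀ k u v → (k ⊙ u) · v ≡ k ⊙ (u · v)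
  ⊙-· k (x , y) (x′ , y′) = cong₂ _,_ (rational k x y x′ y′ (+ D)) (irrational k x y x′ y′)
    where
    rational : ∀ k x y x′ y′ d → (k * x) * x′ + d * ((k * y) * y′) ≡ k * (x * x′ + d * (y * y′))
    rational = solve-∀
    irrational : ∀ k x y x′ y′ → (k * x) * y′ + (k * y) * x′ ≡ k * (x * y′ + y * x′)
    irrational = solve-∀

  ⊙-⊙ : ∀ k j u → k ⊙ (j ⊙ u) ≡ (k * j) ⊙ u
  ⊙-⊙ k j (x , y) = cong₂ _,_ (sym (*-assoc k j x)) (sym (*-assoc k j y))

  BothPositive : ℤ√D → Set
  BothPositive (x , y) = 0ℤ < x × 0ℤ < y

  ·-positive : ∀ u v → BothPositive u → BothPositive v → BothPositive (u · v)
  ·-positive (x , y) (x′ , y′) (0<x , 0<y) (0<x′ , 0<y′) =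
      +-mono-<-≤ (0<i*j 0<x 0<x′) (0≤i*j {+ D} (+≤+ ℕ.z≤n) (<⇒≤ (0<i*j 0<y 0<y′)))
    , +-mono-<-≤ (0<i*j 0<x 0<y′) (<⇒≤ (0<i*j 0<y 0<x′))

  root : ℤ → ℤ√D
  root P = (P , 1ℤ)

  -- difference (P , Q) (P′ , Q′) = Q Q′ ((√D + P)/Q − (√D + P′)/Q′)
  difference : ℤ × ℤ → ℤ × ℤ → ℤ√D
  difference (P , Q) (P′ , Q′) = (P * Q′ - Q * P′ , Q′ - Q)

  -- If ω = b + 1/ω₁ and ω′ = b + 1/ω₁′ then ω − ω′ = (ω₁′ − ω₁)/(ω₁ ω₁′).
  difference-step : ∀ {b P₀ Q₀ P₀′ Q₀′ P₁ Q₁ P₁′ Q₁′} →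
    P₁ ≡ b * Q₀ - P₀ → P₁′ ≡ b * Q₀′ - P₀′ →
    Q₁ * Q₀ ≡ + D - P₁ * P₁ → Q₁′ * Q₀′ ≡ + D - P₁′ * P₁′ →
    difference (P₀ , Q₀) (P₀′ , Q₀′) · (root P₁ · root P₁′)
      ≡ (- (Q₀ * Q₀′)) ⊙ difference (P₁ , Q₁) (P₁′ , Q₁′)
  difference-step {b} {P₀} {Q₀} {P₀′} {Q₀′} {_} {Q₁} {_} {Q₁′} refl refl Q₁Q₀≡ Q₁′Q₀′≡ =
    cong₂ _,_ (modulo ((b * Q₀ - P₀) * Q₀) (Q₀′ * (b * Q₀′ - P₀′))
                      (rational b P₀ Q₀ P₀′ Q₀′ Q₁ Q₁′ (+ D)))
              (modulo Q₀ Q₀′ (irrational b P₀ Q₀ P₀′ Q₀′ Q₁ Q₁′ (+ D)))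
    where
    rational : ∀ b P₀ Q₀ P₀′ Q₀′ Q₁ Q₁′ d →
      let P₁ = b * Q₀ - P₀ ; P₁′ = b * Q₀′ - P₀′ in
      (P₀ * Q₀′ - Q₀ * P₀′) * (P₁ * P₁′ + d * (1ℤ * 1ℤ)) + d * ((Q₀′ - Q₀) * (P₁ * 1ℤ + 1ℤ * P₁′))
        ≡ - (Q₀ * Q₀′) * (P₁ * Q₁′ - Q₁ * P₁′)
          + P₁ * Q₀ * (Q₁′ * Q₀′ - (d - P₁′ * P₁′)) - Q₀′ * P₁′ * (Q₁ * Q₀ - (d - P₁ * P₁))
    rational = solve-∀
    irrational : ∀ b P₀ Q₀ P₀′ Q₀′ Q₁ Q₁′ d →
      let P₁ = b * Q₀ - P₀ ; P₁′ = b * Q₀′ - P₀′ in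
      (P₀ * Q₀′ - Q₀ * P₀′) * (P₁ * 1ℤ + 1ℤ * P₁′) + (Q₀′ - Q₀) * (P₁ * P₁′ + d * (1ℤ * 1ℤ))
        ≡ - (Q₀ * Q₀′) * (Q₁′ - Q₁)
          + Q₀ * (Q₁′ * Q₀′ - (d - P₁′ * P₁′)) - Q₀′ * (Q₁ * Q₀ - (d - P₁ * P₁))
    irrational = solve-∀
    vanish : ∀ z α β → z + α * 0ℤ - β * 0ℤ ≡ z
    vanish = solve-∀

    modulo : ∀ α β {x z} → x ≡ z + α * (Q₁′ * Q₀′ - (+ D - (b * Q₀′ - P₀′) * (b * Q₀′ - P₀′)))
                                 - β * (Q₁ * Q₀ - (+ D - (b * Q₀ - P₀) * (b * Q₀ - P₀))) → x ≡ z
    modulo α β {z = z} x≡ =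
      trans x≡ (trans (cong₂ (λ s t → z + α * s - β * t) (i≡j⇒i-j≡0 Q₁′Q₀′≡) (i≡j⇒i-j≡0 Q₁Q₀≡))
                      (vanish z α β))

  difference≡0⇒≡ : ∀ {P Q P′ Q′} → 0ℤ < Q →
                   difference (P , Q) (P′ , Q′) ≡ (0ℤ , 0ℤ) → (P , Q) ≡ (P′ , Q′)
  difference≡0⇒≡ {P} {Q} {P′} {Q′} 0<Q d≡0 = cong₂ _,_ P≡P′ Q≡Q′
    where
    Q≡Q′ : Q ≡ Q′
    Q≡Q′ = sym (i-j≡0⇒i≡j Q′ Q (,-injectiveʳ d≡0))
    P≡P′ : P ≡ P′
    P≡P′ = *-cancelˡ-≡ Q P P′ {{>-nonZero 0<Q}} (begin
      Q * P  ≡⟨ *-comm Q P ⟩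
      P * Q  ≡⟨ cong (P *_) Q≡Q′ ⟩
      P * Q′ ≡⟨ i-j≡0⇒i≡j (P * Q′) (Q * P′) (,-injectiveˡ d≡0) ⟩
      Q * P′ ∎)
      where open ≡-Reasoning

  module _ (nonsquare : ∀ n → n ℕ.* n ≢ D) where

    D*f*f≢e*e : ∀ e f → f ≢ 0ℤ → + D * (f * f) ≢ e * e
    D*f*f≢e*e e f f≢0 D*f*f≡e*e = nonsquare (proj₁ √D) (proj₂ √D)
      where
      in-ℕ : D ℕ.* (∣ f ∣ ℕ.* ∣ f ∣) ≡ ∣ e ∣ ℕ.* ∣ e ∣
      in-ℕ = begin
        D ℕ.* (∣ f ∣ ℕ.* ∣ f ∣) ≡⟨ cong (D ℕ.*_) (sym (abs-* f f)) ⟩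
        D ℕ.* ∣ f * f ∣         ≡⟨ sym (abs-* (+ D) (f * f)) ⟩
        ∣ + D * (f * f) ∣       ≡⟨ cong ∣_∣ D*f*f≡e*e ⟩
        ∣ e * e ∣               ≡⟨ abs-* e e ⟩
        ∣ e ∣ ℕ.* ∣ e ∣         ∎
        where open ≡-Reasoning

      √D : ∃[ n ] n ℕ.* n ≡ D
      √D = rational-root⇒square D ∣ e ∣ ∣ f ∣ (λ ∣f∣≡0 → f≢0 (∣i∣≡0⇒i≡0 ∣f∣≡0)) in-ℕ

    -- ℤ[√D] has no zero divisors, so an eigenvector of multiplication by y ∉ ℤ is zero.
    eigenvector⇒0 : ∀ c y k → proj₂ y ≢ 0ℤ → c · y ≡ k ⊙ c → c ≡ (0ℤ , 0ℤ)
    eigenvector⇒0 (v , u) (e , f) k f≢0 c·y≡k⊙c = cong₂ _,_ v≡0 u≡0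
      where
      shift₁ : ∀ v u e f k d → v * (e - k) + d * (u * f) ≡ (v * e + d * (u * f)) - k * v
      shift₁ = solve-∀
      shift₂ : ∀ v u e f k → v * f + u * (e - k) ≡ (v * f + u * e) - k * u
      shift₂ = solve-∀
      eliminate : ∀ v u e f d → u * (d * (f * f) - e * e) ≡ f * (v * e + d * (u * f)) - e * (v * f + u * e)
      eliminate = solve-∀
      vanish : ∀ x y → x * 0ℤ - y * 0ℤ ≡ 0ℤ
      vanish = solve-∀

      rational : v * (e - k) + + D * (u * f) ≡ 0ℤ
      rational = trans (shift₁ v u e f k (+ D)) (i≡j⇒i-j≡0 (,-injectiveˡ c·y≡k⊙c))
      irrational : v * f + u * (e - k) ≡ 0ℤ
      irrational = trans (shift₂ v u e f k) (i≡j⇒i-j≡0 (,-injectiveʳ c·y≡k⊙c))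

      u≡0 : u ≡ 0ℤ
      u≡0 with i*j≡0⇒i≡0∨j≡0 u (trans (eliminate v u (e - k) f (+ D))
                                (trans (cong₂ (λ s t → f * s - (e - k) * t) rational irrational) (vanish f (e - k))))
      ... | inj₁ u≡0    = u≡0
      ... | inj₂ norm≡0 = ⊥-elim (D*f*f≢e*e (e - k) f f≢0 (i-j≡0⇒i≡j _ _ norm≡0))

      v≡0 : v ≡ 0ℤ
      v≡0 with i*j≡0⇒i≡0∨j≡0 v (trans (sym (+-identityʳ (v * f)))
                                      (subst (λ x → v * f + x * (e - k) ≡ 0ℤ) u≡0 irrational))
      ... | inj₁ v≡0 = v≡0
      ... | inj₂ f≡0 = ⊥-elim (f≢0 f≡0)

module SqrtContinuedFraction (D : ℕ.ℕ) (0<D : 0 ℕ.< D) (nonsquare : ∀ n → n ℕ.* n ≢ D)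
                             (a P Q : ℕ.ℕ → ℤ) (cf : IsSqrtCF D a P Q) where
  open ℕ using (ℕ; zero; suc)
  open import Data.Integer hiding (suc)
  open import Data.Integer.Properties
  open import Data.Integer.Tactic.RingSolver using (solve-∀)
  open import Data.Product using (_×_; _,_; proj₁; proj₂; ∃-syntax)
  open import Data.Product.Properties using (,-injectiveˡ; ,-injectiveʳ)
  open import Data.Sum using (inj₁; inj₂)
  open import Data.Empty using (⊥-elim)
  open import Relation.Binary.PropositionalEquality
  open import Data.Fin using (Fin; fromℕ<; combine)
  open import Data.Fin.Properties using (combine-injective; fromℕ<-injective)
  open import Function using (_∘_)
  open IsSqrtCF cf
  open IntegerOrder
  open ReducedForms
  open Pigeonhole
  open QuadraticIntegers D

  r : ℤ
  r = a 0

  x*1-0≡x : ∀ x → x * 1ℤ - 0ℤ ≡ x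
  x*1-0≡x x = trans (+-identityʳ (x * 1ℤ)) (*-identityʳ x)

  ≤√D<⇒< : ∀ {x y} → LeSqrt D x → SqrtLt D y → x < y
  ≤√D<⇒< (inj₁ x≤0) (0<y , _) = ≤-<-trans x≤0 0<y
  ≤√D<⇒< {x} {y} (inj₂ x*x≤D) (0<y , D<y*y) = <-byContradiction λ y≤x →
    <-irrefl refl (<-≤-trans D<y*y (≤-trans (y*y≤x*x (0≤i-j⇒j≤i y≤x)) x*x≤D))
    where
    y*y≤x*x : y ≤ x → y * y ≤ x * x
    y*y≤x*x y≤x = ≤-trans (*-monoˡ-≤-nonNeg y {{nonNegative (<⇒≤ 0<y)}} y≤x)
                          (*-monoʳ-≤-nonNeg x {{nonNegative (≤-trans (<⇒≤ 0<y) y≤x)}} y≤x)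

  r-floor : LeSqrt D r × SqrtLt D (r + 1ℤ)
  r-floor with subst₂ (λ p q → IsFloor D p q r) P-zero Q-zero (a-floor 0)
  ... | inj₁ (_ , r≤√D , √D<r+1) =
    subst (LeSqrt D) (x*1-0≡x r) r≤√D , subst (SqrtLt D) (x*1-0≡x (r + 1ℤ)) √D<r+1
  ... | inj₂ (+<+ () , _)

  ≤√D⇒≤r : ∀ {x} → LeSqrt D x → x ≤ r
  ≤√D⇒≤r {x} x≤√D = ≤-byContradiction λ r<x →
    0≤⇒≢-1 (0≤i+j r<x (<⇒0≤ (≤√D<⇒< x≤√D (proj₂ r-floor)))) (certificate x r)
    where
    certificate : ∀ x r → (x - (1ℤ + r)) + ((r + 1ℤ) - (1ℤ + x)) ≡ -1ℤ
    certificate = solve-∀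

  √D<⇒r< : ∀ {y} → SqrtLt D y → r < y
  √D<⇒r< = ≤√D<⇒< (proj₁ r-floor)

  1≤r : 1ℤ ≤ r
  1≤r = ≤√D⇒≤r (inj₂ (+≤+ 0<D))

  r*r<D : r * r < + D
  r*r<D with proj₁ r-floor
  ... | inj₁ r≤0   = ⊥-elim (<-irrefl refl (≤-<-trans 1≤r (≤-<-trans r≤0 (+<+ (ℕ.s≤s ℕ.z≤n)))))
  ... | inj₂ r*r≤D = ≤∧≢⇒< r*r≤D λ r*r≡D → nonsquare ∣ r ∣ (trans (sym (abs-* r r)) (cong ∣_∣ r*r≡D))

  D<[r+1]² : + D < (r + 1ℤ) * (r + 1ℤ)
  D<[r+1]² = proj₂ (proj₂ r-floor)

  a-floorDiv : ∀ k → 0ℤ < Q k → FloorDiv r (P k) (Q k) (a k)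
  a-floorDiv k 0<Q with a-floor k
  ... | inj₁ (_ , lower , upper) = ≤√D⇒≤r lower , √D<⇒r< upper
  ... | inj₂ (Q<0 , _)           = ⊥-elim (<-asym 0<Q Q<0)

  P₁≡r : P 1 ≡ r
  P₁≡r = trans (P-suc 0) (trans (cong₂ (λ p q → r * q - p) P-zero Q-zero) (x*1-0≡x r))

  reduced : ∀ k → Reduced r (P (suc k)) (Q (suc k))
  reduced zero = reduced-flip r*r<D D<[r+1]² initial (Q-suc 0)
    where
    initial : Reduced r (P 1) (Q 0)
    initial rewrite P₁≡r | Q-zero = record
      { P≤r   = ≤-refl
      ; r<P+Q = suc[i]≤j⇒i<j (≤-reflexive (+-comm 1ℤ r))
      ; Q≤r+P = ≤-trans 1≤r (i≤i+j r r {{nonNegative (≤-trans (+≤+ ℕ.z≤n) 1≤r)}})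
      }
  reduced (suc k) = reduced-flip r*r<D D<[r+1]² (subst (λ p → Reduced r p (Q (suc k))) (sym (P-suc (suc k))) step)
                                 (Q-suc (suc k))
    where
    step : Reduced r (a (suc k) * Q (suc k) - P (suc k)) (Q (suc k))
    step = floorDiv-step (reduced k) {a (suc k)} (a-floorDiv (suc k) (reduced-Q>0 (reduced k)))

  0<Q : ∀ k → 0ℤ < Q (suc k)
  0<Q k = reduced-Q>0 (reduced k)

  state : ℕ → ℤ × ℤ
  state k = P k , Q k

  P-pred : ∀ k → P k ≡ a k * Q k - P (suc k)
  P-pred k = trans (sym (cancel (a k * Q k) (P k))) (cong (λ x → a k * Q k - x) (sym (P-suc k)))
    where
    cancel : ∀ x y → x - (x - y) ≡ y
    cancel = solve-∀

  Q*Q-cong : ∀ {k m} → P (suc k) ≡ P (suc m) → Q (suc k) * Q k ≡ Q (suc m) * Q m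
  Q*Q-cong {k} {m} P≡ = trans (Q-suc k) (trans (cong (λ x → + D - x * x) P≡) (sym (Q-suc m)))

  a-floorDiv-next : ∀ k → FloorDiv r (P (suc k)) (Q (suc k)) (a (suc k))
  a-floorDiv-next k = a-floorDiv (suc k) (0<Q k)

  a-floorDiv-prev : ∀ k → FloorDiv r (P (suc (suc k))) (Q (suc k)) (a (suc k))
  a-floorDiv-prev k = subst (λ p → FloorDiv r p (Q (suc k)) (a (suc k))) (sym (P-suc (suc k)))
                            (floorDiv-reverse (reduced k) (a (suc k)))

  state-step : ∀ {k m} → state (suc k) ≡ state (suc m) → state (suc (suc k)) ≡ state (suc (suc m))
  state-step {k} {m} s = cong₂ _,_ P≡ Q≡
    where
    P₁≡ : P (suc k) ≡ P (suc m)
    P₁≡ = ,-injectiveˡ s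
    Q₁≡ : Q (suc k) ≡ Q (suc m)
    Q₁≡ = ,-injectiveʳ s
    a≡ : a (suc k) ≡ a (suc m)
    a≡ = floorDiv-unique (0<Q k) (a-floorDiv-next k)
           (subst₂ (λ p q → FloorDiv r p q (a (suc m))) (sym P₁≡) (sym Q₁≡) (a-floorDiv-next m))
    P≡ : P (suc (suc k)) ≡ P (suc (suc m))
    P≡ = trans (P-suc (suc k)) (trans (cong₂ _-_ (cong₂ _*_ a≡ Q₁≡) P₁≡) (sym (P-suc (suc m))))
    Q≡ : Q (suc (suc k)) ≡ Q (suc (suc m))
    Q≡ = *-cancelʳ-≡ _ _ (Q (suc k)) {{>-nonZero (0<Q k)}}
           (trans (Q*Q-cong P≡) (cong (Q (suc (suc m)) *_) (sym Q₁≡)))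

  state-step-back : ∀ {k m} → state (suc (suc k)) ≡ state (suc (suc m)) → state (suc k) ≡ state (suc m)
  state-step-back {k} {m} s = cong₂ _,_ P≡ Q≡
    where
    P₂≡ : P (suc (suc k)) ≡ P (suc (suc m))
    P₂≡ = ,-injectiveˡ s
    Q₂≡ : Q (suc (suc k)) ≡ Q (suc (suc m))
    Q₂≡ = ,-injectiveʳ s
    Q≡ : Q (suc k) ≡ Q (suc m)
    Q≡ = *-cancelˡ-≡ (Q (suc (suc k))) _ _ {{>-nonZero (0<Q (suc k))}}
           (trans (Q*Q-cong P₂≡) (cong (_* Q (suc m)) (sym Q₂≡)))
    a≡ : a (suc k) ≡ a (suc m)
    a≡ = floorDiv-unique (0<Q k) (a-floorDiv-prev k)
           (subst₂ (λ p q → FloorDiv r p q (a (suc m))) (sym P₂≡) (sym Q≡) (a-floorDiv-prev m))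
    P≡ : P (suc k) ≡ P (suc m)
    P≡ = trans (P-pred (suc k)) (trans (cong₂ _-_ (cong₂ _*_ a≡ Q≡) P₂≡) (sym (P-pred (suc m))))

  reflection-step : ∀ {j m} → P (3 ℕ.+ m) ≡ P (suc j) → Q (2 ℕ.+ m) ≡ Q (suc j) →
                    P (2 ℕ.+ m) ≡ P (2 ℕ.+ j) × Q (suc m) ≡ Q (2 ℕ.+ j)
  reflection-step {j} {m} P₃≡ Q₂≡ = P≡ , Q≡
    where
    a≡ : a (2 ℕ.+ m) ≡ a (suc j)
    a≡ = floorDiv-unique (0<Q j)
           (subst₂ (λ p q → FloorDiv r p q (a (2 ℕ.+ m))) P₃≡ Q₂≡ (a-floorDiv-prev (suc m)))
           (a-floorDiv-next j)
    P≡ : P (2 ℕ.+ m) ≡ P (2 ℕ.+ j)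
    P≡ = trans (P-pred (2 ℕ.+ m)) (trans (cong₂ _-_ (cong₂ _*_ a≡ Q₂≡) P₃≡) (sym (P-suc (suc j))))
    Q≡ : Q (suc m) ≡ Q (2 ℕ.+ j)
    Q≡ = *-cancelˡ-≡ (Q (suc j)) _ _ {{>-nonZero (0<Q j)}} (begin
      Q (suc j) * Q (suc m)      ≡⟨ cong (_* Q (suc m)) (sym Q₂≡) ⟩
      Q (2 ℕ.+ m) * Q (suc m)    ≡⟨ Q*Q-cong P≡ ⟩
      Q (2 ℕ.+ j) * Q (suc j)    ≡⟨ *-comm (Q (2 ℕ.+ j)) (Q (suc j)) ⟩
      Q (suc j) * Q (2 ℕ.+ j)    ∎)
      where open ≡-Reasoning

  end-of-period : ∀ m → state 1 ≡ state (3 ℕ.+ m) → P (2 ℕ.+ m) ≡ P 1 × Q (suc m) ≡ Q 1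
  end-of-period m s = trans P₂≡r (sym P₁≡r) , Q≡
    where
    Q₂≡1 : Q (2 ℕ.+ m) ≡ 1ℤ
    Q₂≡1 = *-cancelˡ-≡ (Q 1) _ _ {{>-nonZero (0<Q 0)}} (begin
      Q 1 * Q (2 ℕ.+ m)          ≡⟨ cong (_* Q (2 ℕ.+ m)) (,-injectiveʳ s) ⟩
      Q (3 ℕ.+ m) * Q (2 ℕ.+ m)  ≡⟨ Q*Q-cong (sym (,-injectiveˡ s)) ⟩
      Q 1 * Q 0                  ≡⟨ cong (Q 1 *_) Q-zero ⟩
      Q 1 * 1ℤ                   ∎)
      where open ≡-Reasoning
    P₂≡r : P (2 ℕ.+ m) ≡ r
    P₂≡r = ≤-antisym P≤r (≤-byContradiction λ P<r →
      0≤⇒≢-1 (0≤i+j P<r (<⇒0≤ (subst (λ q → r < P (2 ℕ.+ m) + q) Q₂≡1 r<P+Q))) (certificate r (P (2 ℕ.+ m))))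
      where
      open Reduced (reduced (suc m))
      certificate : ∀ r p → (r - (1ℤ + p)) + (p + 1ℤ - (1ℤ + r)) ≡ -1ℤ
      certificate = solve-∀
    Q≡ : Q (suc m) ≡ Q 1
    Q≡ = begin
      Q (suc m)                  ≡⟨ sym (*-identityˡ (Q (suc m))) ⟩
      1ℤ * Q (suc m)             ≡⟨ cong (_* Q (suc m)) (sym Q₂≡1) ⟩
      Q (2 ℕ.+ m) * Q (suc m)    ≡⟨ Q*Q-cong (trans P₂≡r (sym P₁≡r)) ⟩
      Q 1 * Q 0                  ≡⟨ cong (Q 1 *_) Q-zero ⟩
      Q 1 * 1ℤ                   ≡⟨ *-identityʳ (Q 1) ⟩
      Q 1                        ∎
      where open ≡-Reasoning

  palindrome : ∀ {l} → state 1 ≡ state (suc l) → ∀ j m → suc j ℕ.+ suc m ≡ l →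
               P (2 ℕ.+ m) ≡ P (suc j) × Q (suc m) ≡ Q (suc j)
  palindrome s zero    m refl = end-of-period m s
  palindrome s (suc j) m refl with palindrome s j (suc m) (cong suc (ℕₚ.+-suc j (suc m)))
  ... | P₃≡ , Q₂≡ = reflection-step P₃≡ Q₂≡

  state-shift : ∀ {p} → state 1 ≡ state (suc p) → ∀ n → state (suc n) ≡ state (suc n ℕ.+ p)
  state-shift s zero    = s
  state-shift s (suc n) = state-step (state-shift s n)

  state-unshift : ∀ {p} i → state (suc i) ≡ state (suc i ℕ.+ p) → state 1 ≡ state (suc p)
  state-unshift zero    s = s
  state-unshift (suc i) s = state-unshift i (state-step-back s)

  R : ℕ
  R = ∣ r ∣

  R≡r : + R ≡ r
  R≡r = 0≤i⇒+∣i∣≡i (≤-trans (+≤+ ℕ.z≤n) 1≤r)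

  0≤P : ∀ n → 0ℤ ≤ P (suc n)
  0≤P n = <⇒≤ (reduced-P>0 (reduced n))

  0≤Q : ∀ n → 0ℤ ≤ Q (suc n)
  0≤Q n = <⇒≤ (0<Q n)

  ∣P∣<1+R : ∀ n → ∣ P (suc n) ∣ ℕ.< suc R
  ∣P∣<1+R n = ∣i∣<1+n (0≤P n) (subst (P (suc n) ≤_) (sym R≡r) P≤r)
    where open Reduced (reduced n)

  ∣Q∣<1+2R : ∀ n → ∣ Q (suc n) ∣ ℕ.< suc (R ℕ.+ R)
  ∣Q∣<1+2R n = ∣i∣<1+n (0≤Q n) (subst (Q (suc n) ≤_) (trans (cong₂ _+_ (sym R≡r) (sym R≡r)) (sym (pos-+ R R)))
                                    (≤-trans Q≤r+P (+-monoʳ-≤ r P≤r)))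
    where open Reduced (reduced n)

  code : ℕ → Fin (suc R ℕ.* suc (R ℕ.+ R))
  code n = combine (fromℕ< (∣P∣<1+R n)) (fromℕ< (∣Q∣<1+2R n))

  code-injective : ∀ i j → code i ≡ code j → state (suc i) ≡ state (suc j)
  code-injective i j code≡ = cong₂ _,_
    (0≤⇒∣∣-injective (0≤P i) (0≤P j) (fromℕ<-injective _ _ (∣P∣<1+R i) (∣P∣<1+R j) (proj₁ components)))
    (0≤⇒∣∣-injective (0≤Q i) (0≤Q j) (fromℕ<-injective _ _ (∣Q∣<1+2R i) (∣Q∣<1+2R j) (proj₂ components)))
    where
    components : fromℕ< (∣P∣<1+R i) ≡ fromℕ< (∣P∣<1+R j) × fromℕ< (∣Q∣<1+2R i) ≡ fromℕ< (∣Q∣<1+2R j)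
    components = combine-injective _ _ _ _ code≡

  state-recurs : ∃[ p ] state 1 ≡ state (2 ℕ.+ p)
  state-recurs = o , state-unshift i (subst (λ x → state (suc i) ≡ state (suc x)) (sym (ℕₚ.+-suc i o))
                                            (code-injective i (suc i ℕ.+ o) code≡))
    where
    i : ℕ
    i = proj₁ (sequence-repeats code)
    o : ℕ
    o = proj₁ (proj₂ (sequence-repeats code))
    code≡ : code i ≡ code (suc i ℕ.+ o)
    code≡ = proj₂ (proj₂ (sequence-repeats code))

  a-periodic⇒state-periodic : ∀ {l} → IsPeriod a l → state 1 ≡ state (suc l)
  a-periodic⇒state-periodic {l} period = difference≡0⇒≡ (0<Q 0)
      (eigenvector⇒0 nonsquare (c 1) (y p) (proj₁ (scaled p))
        (λ y₂≡0 → <-irrefl (sym y₂≡0) (proj₂ (y-positive p)))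
        (trans (proj₂ (scaled p)) (cong (proj₁ (scaled p) ⊙_) c-periodic)))
    where
    p : ℕ
    p = proj₁ state-recurs
    recur : state 1 ≡ state (2 ℕ.+ p)
    recur = proj₂ state-recurs

    c : ℕ → ℤ√D
    c k = difference (state k) (state (k ℕ.+ l))

    z : ℕ → ℤ√D
    z k = root (P k) · root (P (k ℕ.+ l))

    step : ∀ n → c (suc n) · z (2 ℕ.+ n) ≡ (- (Q (suc n) * Q (suc n ℕ.+ l))) ⊙ c (2 ℕ.+ n)
    step n = difference-step {a (suc n)} {P (suc n)} {Q (suc n)} {P (suc n ℕ.+ l)} {Q (suc n ℕ.+ l)}
                             {P (2 ℕ.+ n)} {Q (2 ℕ.+ n)} {P (2 ℕ.+ n ℕ.+ l)} {Q (2 ℕ.+ n ℕ.+ l)}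
               (P-suc (suc n))
               (trans (P-suc (suc n ℕ.+ l))
                      (cong (λ b → b * Q (suc n ℕ.+ l) - P (suc n ℕ.+ l)) (period (suc n) (ℕ.s≤s ℕ.z≤n))))
               (Q-suc (suc n)) (Q-suc (suc n ℕ.+ l))

    y : ℕ → ℤ√D
    y zero    = z 2
    y (suc n) = y n · z (3 ℕ.+ n)

    z-positive : ∀ k → BothPositive (z (suc k))
    z-positive k = ·-positive (root (P (suc k))) (root (P (suc k ℕ.+ l)))
                              (reduced-P>0 (reduced k) , +<+ (ℕ.s≤s ℕ.z≤n))
                              (reduced-P>0 (reduced (k ℕ.+ l)) , +<+ (ℕ.s≤s ℕ.z≤n))

    y-positive : ∀ n → BothPositive (y n)
    y-positive zero    = z-positive 1
    y-positive (suc n) = ·-positive (y n) (z (3 ℕ.+ n)) (y-positive n) (z-positive (2 ℕ.+ n))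

    scaled : ∀ n → ∃[ x ] c 1 · y n ≡ x ⊙ c (2 ℕ.+ n)
    scaled zero    = - (Q 1 * Q (1 ℕ.+ l)) , step 0
    scaled (suc n) = x * q , (begin
      c 1 · (y n · z (3 ℕ.+ n))         ≡⟨ sym (·-assoc (c 1) (y n) (z (3 ℕ.+ n))) ⟩
      c 1 · y n · z (3 ℕ.+ n)           ≡⟨ cong (_· z (3 ℕ.+ n)) (proj₂ (scaled n)) ⟩
      (x ⊙ c (2 ℕ.+ n)) · z (3 ℕ.+ n)   ≡⟨ ⊙-· x (c (2 ℕ.+ n)) (z (3 ℕ.+ n)) ⟩
      x ⊙ (c (2 ℕ.+ n) · z (3 ℕ.+ n))   ≡⟨ cong (x ⊙_) (step (suc n)) ⟩
      x ⊙ (q ⊙ c (3 ℕ.+ n))             ≡⟨ ⊙-⊙ x q (c (3 ℕ.+ n)) ⟩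
      (x * q) ⊙ c (3 ℕ.+ n)             ∎)
      where
      open ≡-Reasoning
      x : ℤ
      x = proj₁ (scaled n)
      q : ℤ
      q = - (Q (2 ℕ.+ n) * Q (2 ℕ.+ n ℕ.+ l))

    c-periodic : c (2 ℕ.+ p) ≡ c 1
    c-periodic = cong₂ difference (sym recur)
      (sym (trans (state-shift recur l) (cong (state ∘ suc) (trans (ℕₚ.+-suc l p) (cong suc (ℕₚ.+-comm l p))))))

  P-fixed⇒aQ≡2P : ∀ k → P (suc k) ≡ P k → a k * Q k ≡ P k + P k
  P-fixed⇒aQ≡2P k P≡ = trans (sym (split (a k * Q k) (P k))) (cong (_+ P k) (trans (sym (P-suc k)) P≡))
    where
    split : ∀ x y → (x - y) + y ≡ x
    split = solve-∀

  D≡P*P+Q*Q : ∀ k → + D ≡ P (suc k) * P (suc k) + Q (suc k) * Q k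
  D≡P*P+Q*Q k = trans (sym (split (+ D) (P (suc k) * P (suc k)))) (cong (λ x → P (suc k) * P (suc k) + x) (sym (Q-suc k)))
    where
    split : ∀ x y → y + (x - y) ≡ x
    split = solve-∀

open import Data.Nat using (ℕ; _*_; _<_)
open import Data.Integer using (ℤ; +_; _-_)
open import Data.Integer.Divisibility using (_∣_)
open import Relation.Binary.PropositionalEquality using (_≢_)
open import Relation.Nullary using (¬_)

proposition2p4 : (D : ℕ) → 0 < D → (∀ n → n * n ≢ D) →
    (a P Q : ℕ → ℤ) → IsSqrtCF D a P Q →
    (L : ℕ) → 0 < L → IsMinPeriod a (2 * L) →
    (+ 2) ∣ Q L → ¬ ((+ 4) ∣ Q L) →
    (+ 2) ∣ (a L - + D)
proposition2p4 D 0<D nonsquare a P Q cf (ℕ.suc L) _ (_ , period , _) 2∣Q 4∤Q =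
  parity {a (ℕ.suc L)} {Q (ℕ.suc L)} {P (ℕ.suc L)} {+ D} {Q L}
         (P-fixed⇒aQ≡2P (ℕ.suc L) centre) (D≡P*P+Q*Q L) 2∣Q 4∤Q
  where
  open Parity using (parity)
  open SqrtContinuedFraction D 0<D nonsquare a P Q cf
  centre : P (2 ℕ.+ L) ≡ P (ℕ.suc L)
  centre = proj₁ (palindrome (a-periodic⇒state-periodic period) L L
                             (cong (ℕ.suc L ℕ.+_) (sym (ℕₚ.+-identityʳ (ℕ.suc L)))))
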